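{- For every instance of MLCM-P\_PATH there exists an optimal layout with the following property: whenever two lines $l=[i,j]$ and $l'=[i',j']$ with $j<j'$ cross, the crossing occurs on edge $(j-1,j)$.
   Context: Stations $1,\dots,n$ lie on a horizontal line, joined by edges $(i,i+1)$. A line is $[i,j]$ with $1\le i<j\le n$, travelling along edges $(i,i+1),\dots,(j-1,j)$; $\mathcal L$ is a finite set of pairwise distinct lines; $\mathcal L_{i,i+1}$ is the set of lines traversing edge $(i,i+1)$; $[a,b]$ passes through station $i$ if $a<i<b$. A layout specifies, for every edge, a top-to-bottom order of its lines at each of its two ends; two lines cross on an edge if their orders differ at the two ends; the crossing number counts (pair, edge) crossings. Admissible: lines passing through station $i$ keep the same relative order at the station-$i$ ends of edges $(i-1,i)$ and $(i,i+1)$. Periphery condition: each line $[a,b]$ is above all or below all lines passing through $a$ at the station-$a$ end of $(a,a+1)$, and above all or below all lines passing through $b$ at the station-$b$ end of $(b-1,b)$. An optimal layout for MLCM-P\_PATH is an admissible layout satisfying the periphery condition with minimum crossing number. -}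

module Defs where

open import Data.Nat using (ℕ; zero; suc; _+_; _≤_; _<_)
import Data.Nat as ℕ
open import Data.Nat.Properties using () renaming (_≟_ to _≟ℕ_)
open import Data.Bool using (Bool; true; false; if_then_else_; _∧_; _∨_)
open import Data.Product using (_×_; _,_; proj₁; proj₂)
open import Data.Product.Properties using (≡-dec)
open import Data.List using (List; []; _∷_; filter; map; upTo; drop)
open import Data.Nat.ListAction using (sum)
open import Data.List.Membership.Propositional using (_∈_)
open import Data.List.Relation.Unary.All using (All)
open import Data.List.Relation.Unary.Unique.Propositional using (Unique)
open import Data.List.Relation.Binary.Permutation.Propositional using (_↭_)
open import Relation.Nullary using (Dec; yes; no; ¬_)
open import Relation.Nullary.Decidable using (⌊_⌋; _×-dec_)
open import Relation.Binary.PropositionalEquality using (_≡_)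
open import Relation.Binary.Definitions using (DecidableEquality)

Line : Set
Line = ℕ × ℕ

_≟L_ : DecidableEquality Line
_≟L_ = ≡-dec _≟ℕ_ _≟ℕ_

ValidLine : ℕ → Line → Set
ValidLine n (a , b) = 1 ≤ a × a < b × b ≤ n

record Instance : Set where
  field
    n     : ℕ
    lines : List Line
    valid : All (ValidLine n) lines
    distinct : Unique lines

-- edge e denotes edge (e , e+1); the edges are e = 1 .. n-1
edges : ℕ → List ℕ
edges n = drop 1 (upTo n)

IsEdge : ℕ → ℕ → Set
IsEdge n e = 1 ≤ e × e + 1 ≤ n

Traverses : Line → ℕ → Set
Traverses (a , b) e = a ≤ e × e + 1 ≤ b

traverses? : (l : Line) → (e : ℕ) → Dec (Traverses l e)
traverses? (a , b) e = (a ℕ.≤? e) ×-dec ((e + 1) ℕ.≤? b)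

PassesThrough : Line → ℕ → Set
PassesThrough (a , b) i = a < i × i < b

linesOn : List Line → ℕ → List Line
linesOn ls e = filter (λ l → traverses? l e) ls

-- The two ends of an edge (e,e+1): L = end at station e, R = end at station e+1
data End : Set where
  L R : End

-- A layout gives, for every edge e and each end, a top-to-bottom list of lines.
Layout : Set
Layout = ℕ → End → List Line

elem : Line → List Line → Bool
elem l [] = false
elem l (x ∷ xs) = ⌊ l ≟L x ⌋ ∨ elem l xs

above : List Line → Line → Line → Bool
above [] l l' = false
above (x ∷ xs) l l' = if ⌊ l ≟L x ⌋ then elem l' xs else above xs l l'

WellFormed : Instance → Layout → Set
WellFormed I lay = ∀ e → IsEdge (Instance.n I) e → ∀ s → lay e s ↭ linesOn (Instance.lines I) e

Admissible : Instance → Layout → Set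
Admissible I lay = ∀ i → 1 < i → i < Instance.n I →
  ∀ l l' → l ∈ Instance.lines I → l' ∈ Instance.lines I →
  PassesThrough l i → PassesThrough l' i →
  above (lay (ℕ.pred i) R) l l' ≡ above (lay i L) l l'

Extreme : List Line → List Line → ℕ → Line → Set
Extreme ls xs s l =
  (∀ l' → l' ∈ ls → PassesThrough l' s → above xs l l' ≡ true)
  ⊎' (∀ l' → l' ∈ ls → PassesThrough l' s → above xs l' l ≡ true)
  where
  open import Data.Sum using () renaming (_⊎_ to _⊎'_)

Periphery : Instance → Layout → Set
Periphery I lay = ∀ a b → (a , b) ∈ Instance.lines I →
  Extreme (Instance.lines I) (lay a L) a (a , b) ×
  Extreme (Instance.lines I) (lay (ℕ.pred b) R) b (a , b)

-- number of crossing (unordered) pairs on edge e: ordered pairs (l,l') with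
-- l above l' at the left end and l' above l at the right end
crossingsOn : Instance → Layout → ℕ → ℕ
crossingsOn I lay e =
  sum (map (λ l → sum (map (λ l' →
        if above (lay e L) l l' ∧ above (lay e R) l' l then 1 else 0)
      (Instance.lines I))) (Instance.lines I))

crossingNumber : Instance → Layout → ℕ
crossingNumber I lay = sum (map (crossingsOn I lay) (edges (Instance.n I)))

Cross : Layout → ℕ → Line → Line → Set
Cross lay e l l' = Traverses l e × Traverses l' e ×
  ¬ (above (lay e L) l l' ≡ above (lay e R) l l')

Feasible : Instance → Layout → Set
Feasible I lay = WellFormed I lay × Admissible I lay × Periphery I lay

Optimal : Instance → Layout → Set
Optimal I lay = Feasible I lay ×
  (∀ lay' → Feasible I lay' → crossingNumber I lay ≤ crossingNumber I lay')

-- Every feasible layout determines, for each line, whether it enters above or below all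
-- lines passing through its first station and whether it leaves above or below all lines
-- passing through its last station.  From these bits we build a canonical layout: the left
-- end of every edge is sorted by one global key, and at the right end of edge (e, e+1) the
-- lines ending at e+1 are moved to the side on which they leave.  This layout is feasible
-- and two lines can only swap on their last common edge.  Whenever it swaps a pair, the
-- given layout agrees with it on the relative order of that pair at the station where the
-- later line starts and at the right end of the swapping edge, so by admissibility it swaps
-- the pair somewhere in between.  Hence the canonical layout has no more crossings, and
-- minimising over the finitely many choices of bits yields an optimal layout of this shape.
module Submission where

open import Defs
open import Data.Nat using (ℕ; zero; suc; pred; _+_; _*_; _∸_; _⊓_; _<_; _≤_; _<?_; _<ᵇ_; z≤n; s≤s)
open import Data.Nat.Properties
open import Data.Nat.ListAction using (sum)
open import Data.Bool using (Bool; true; false; if_then_else_; _∧_)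
import Data.Bool as Bool
open import Data.Product using (Σ; ∃; _×_; _,_; proj₁; proj₂)
import Data.Product as Product
open import Data.Sum using (_⊎_; inj₁; inj₂)
open import Data.Empty using (⊥-elim)
open import Function using (_∘_)
open import Data.List using (List; []; _∷_; _++_; map; filter; cartesianProduct)
open import Data.List.Properties using (map-cong)
open import Data.List.Membership.Propositional using (_∈_; _∉_; find)
open import Data.List.Membership.Propositional.Properties
  using (∈-applyUpTo⁺; ∈-filter⁺; ∈-filter⁻; ∈-++⁺ˡ; ∈-++⁺ʳ; ∈-map⁺; ∈-cartesianProduct⁺)
open import Data.List.Relation.Unary.Any using (here; there)
open import Data.List.Relation.Unary.All as All using (All; []; _∷_)
open import Data.List.Relation.Unary.All.Properties using (¬All⇒Any¬)
open import Data.List.Relation.Unary.AllPairs using (AllPairs; []; _∷_)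
open import Data.List.Relation.Unary.Unique.Propositional using (Unique)
import Data.List.Relation.Unary.Unique.Propositional.Properties as Unique
open import Data.List.Relation.Binary.Permutation.Propositional using (_↭_; ↭-sym; ↭⇒↭ₛ)
open import Data.List.Relation.Binary.Permutation.Propositional.Properties using (∈-resp-↭)
import Data.List.Relation.Binary.Permutation.Setoid.Properties as PermutationSetoid
open import Relation.Nullary using (Dec; yes; no; ¬_; contradiction)
open import Relation.Nullary.Decidable using (⌊_⌋; _×-dec_; _→-dec_)
open import Relation.Unary using (Decidable)
open import Relation.Binary.Definitions using (tri<; tri≈; tri>)
open import Relation.Binary.PropositionalEquality
  using (_≡_; _≢_; refl; sym; trans; cong; cong₂; subst; subst₂; setoid; module ≡-Reasoning)
import Relation.Binary.Construct.On as On

∈⇒elem : ∀ {x xs} → x ∈ xs → elem x xs ≡ true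
∈⇒elem {x} {y ∷ xs} x∈ with x ≟L y | x∈
... | yes _ | _ = refl
... | no x≢y | here x≡y = ⊥-elim (x≢y x≡y)
... | no _ | there x∈xs = ∈⇒elem x∈xs

elem⇒∈ : ∀ {x xs} → elem x xs ≡ true → x ∈ xs
elem⇒∈ {x} {y ∷ xs} eq with x ≟L y
... | yes x≡y = here x≡y
... | no _ = there (elem⇒∈ eq)

∉⇒elem : ∀ {x xs} → x ∉ xs → elem x xs ≡ false
∉⇒elem {x} {xs} x∉ with elem x xs in eq
... | true = ⊥-elim (x∉ (elem⇒∈ eq))
... | false = refl

elem-filter : ∀ {P : Line → Set} (P? : Decidable P) {l xs} → l ∈ xs → elem l (filter P? xs) ≡ ⌊ P? l ⌋
elem-filter P? {l} {xs} l∈ with P? l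
... | yes pl = ∈⇒elem (∈-filter⁺ P? l∈ pl)
... | no ¬pl = ∉⇒elem (λ l∈′ → ¬pl (proj₂ (∈-filter⁻ P? {xs = xs} l∈′)))

above⇒∈ : ∀ {x y} xs → above xs x y ≡ true → x ∈ xs × y ∈ xs
above⇒∈ {x} (z ∷ xs) eq with x ≟L z
... | yes x≡z = here x≡z , there (elem⇒∈ eq)
... | no _ = Product.map there there (above⇒∈ xs eq)

above-∉ʳ : ∀ {x y} xs → y ∉ xs → above xs x y ≡ false
above-∉ʳ {x} {y} xs y∉ with above xs x y in eq
... | true = ⊥-elim (y∉ (proj₂ (above⇒∈ xs eq)))
... | false = refl

above-total : ∀ {x y xs} → x ∈ xs → y ∈ xs → x ≢ y → above xs x y ≡ true ⊎ above xs y x ≡ true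
above-total {x} {y} {z ∷ xs} x∈ y∈ x≢y with x ≟L z | y ≟L z | x∈ | y∈
... | yes refl | yes refl | _ | _ = ⊥-elim (x≢y refl)
... | yes _ | no y≢z | _ | here y≡z = ⊥-elim (y≢z y≡z)
... | yes _ | no _ | _ | there y∈xs = inj₁ (∈⇒elem y∈xs)
... | no x≢z | _ | here x≡z | _ = ⊥-elim (x≢z x≡z)
... | no _ | yes _ | there x∈xs | _ = inj₂ (∈⇒elem x∈xs)
... | no _ | no y≢z | there _ | here y≡z = ⊥-elim (y≢z y≡z)
... | no _ | no _ | there x∈xs | there y∈xs = above-total x∈xs y∈xs x≢y

above-trans : ∀ {x y z xs} → Unique xs → above xs x y ≡ true → above xs y z ≡ true → above xs x z ≡ true
above-trans {x} {y} {z} {w ∷ xs} (w∉ ∷ u) xy yz with x ≟L w | y ≟L w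
... | yes _ | yes refl = ⊥-elim (All.lookup w∉ (elem⇒∈ xy) refl)
... | yes _ | no _ = ∈⇒elem (proj₂ (above⇒∈ xs yz))
... | no _ | yes refl = ⊥-elim (All.lookup w∉ (proj₂ (above⇒∈ xs xy)) refl)
... | no _ | no _ = above-trans u xy yz

unique-↭ : ∀ {xs ys : List Line} → xs ↭ ys → Unique xs → Unique ys
unique-↭ p = PermutationSetoid.Unique-resp-↭ (setoid Line) (↭⇒↭ₛ p)

<⇒<ᵇ≡true : ∀ {m n} → m < n → (m <ᵇ n) ≡ true
<⇒<ᵇ≡true {zero} {suc n} _ = refl
<⇒<ᵇ≡true {suc m} {suc n} (s≤s m<n) = <⇒<ᵇ≡true m<n

≥⇒<ᵇ≡false : ∀ {m n} → n ≤ m → (m <ᵇ n) ≡ false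
≥⇒<ᵇ≡false z≤n = refl
≥⇒<ᵇ≡false (s≤s n≤m) = ≥⇒<ᵇ≡false n≤m

<ᵇ≡true⇒< : ∀ {m n} → (m <ᵇ n) ≡ true → m < n
<ᵇ≡true⇒< {zero} {suc n} _ = s≤s z≤n
<ᵇ≡true⇒< {suc m} {suc n} eq = s≤s (<ᵇ≡true⇒< eq)

+-<ᵇ : ∀ m {x y} → (m + x <ᵇ m + y) ≡ (x <ᵇ y)
+-<ᵇ zero = refl
+-<ᵇ (suc m) = +-<ᵇ m

module _ (f : Line → ℕ) where

  StrictlySorted : List Line → Set
  StrictlySorted = AllPairs (λ x y → f x < f y)

  above-strictlySorted : ∀ {x y xs} → StrictlySorted xs → x ∈ xs → y ∈ xs →
    above xs x y ≡ (f x <ᵇ f y)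
  above-strictlySorted {x} {y} {z ∷ xs} (z< ∷ sorted) x∈ y∈ with x ≟L z | x∈ | y∈
  ... | yes refl | _ | here refl =
    trans (∉⇒elem (λ x∈xs → <-irrefl refl (All.lookup z< x∈xs))) (sym (≥⇒<ᵇ≡false (≤-refl {f x})))
  ... | yes refl | _ | there y∈xs = trans (∈⇒elem y∈xs) (sym (<⇒<ᵇ≡true (All.lookup z< y∈xs)))
  ... | no x≢z | here x≡z | _ = ⊥-elim (x≢z x≡z)
  ... | no _ | there x∈xs | here refl = trans (above-∉ʳ xs (λ y∈xs → <-irrefl refl (All.lookup z< y∈xs)))
    (sym (≥⇒<ᵇ≡false (<⇒≤ (All.lookup z< x∈xs))))
  ... | no _ | there x∈xs | there y∈xs = above-strictlySorted sorted x∈xs y∈xs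

  strictlySorted : ∀ {xs} → Unique xs → (∀ {x y} → x ∈ xs → y ∈ xs → f x ≡ f y → x ≡ y) →
    AllPairs (λ x y → f x ≤ f y) xs → StrictlySorted xs
  strictlySorted [] _ [] = []
  strictlySorted (z∉ ∷ u) inj (z≤ ∷ sorted) =
    All.tabulate (λ y∈ → ≤∧≢⇒< (All.lookup z≤ y∈)
      (λ eq → All.lookup z∉ y∈ (inj (here refl) (there y∈) eq)))
    ∷ strictlySorted u (λ x∈ y∈ → inj (there x∈) (there y∈)) sorted

module SortOn (f : Line → ℕ) where
  private
    order = On.decTotalOrder ≤-decTotalOrder f
  open import Data.List.Sort order public using (sort; sort-↭)
  open import Data.List.Sort order using (sort-↗)
  open import Data.List.Relation.Unary.Sorted.TotalOrder.Properties using (Sorted⇒AllPairs)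
  open import Relation.Binary.Bundles using (DecTotalOrder)

  above-sort : ∀ {xs x y} → Unique xs → (∀ {x y} → x ∈ xs → y ∈ xs → f x ≡ f y → x ≡ y) →
    x ∈ xs → y ∈ xs → above (sort xs) x y ≡ (f x <ᵇ f y)
  above-sort {xs} u inj x∈ y∈ =
    above-strictlySorted f
      (strictlySorted f (unique-↭ (↭-sym (sort-↭ xs)) u) (λ x∈ y∈ → inj (fromSort x∈) (fromSort y∈))
        (Sorted⇒AllPairs (DecTotalOrder.totalOrder order) (sort-↗ xs)))
      (toSort x∈) (toSort y∈)
    where
    fromSort : ∀ {z} → z ∈ sort xs → z ∈ xs
    fromSort = ∈-resp-↭ (sort-↭ xs)
    toSort : ∀ {z} → z ∈ xs → z ∈ sort xs
    toSort = ∈-resp-↭ (↭-sym (sort-↭ xs))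

lex-<ʰ : ∀ {Q h h' w w'} → w < Q → h < h' → h * Q + w < h' * Q + w'
lex-<ʰ {Q} {h} {h'} {w} {w'} w<Q h<h' = begin-strict
  h * Q + w   <⟨ +-monoʳ-< (h * Q) w<Q ⟩
  h * Q + Q   ≡⟨ +-comm (h * Q) Q ⟩
  suc h * Q   ≤⟨ *-monoˡ-≤ Q h<h' ⟩
  h' * Q      ≤⟨ m≤m+n (h' * Q) w' ⟩
  h' * Q + w' ∎
  where open ≤-Reasoning

lex-<⁻¹ : ∀ {Q h h' w w'} → w' < Q → h * Q + w < h' * Q + w' → h < h' ⊎ (h ≡ h' × w < w')
lex-<⁻¹ {Q} {h} {h'} w'<Q lt with <-cmp h h'
... | tri< h<h' _ _ = inj₁ h<h'
... | tri≈ _ refl _ = inj₂ (refl , +-cancelˡ-< (h * Q) _ _ lt)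
... | tri> _ _ h'<h = ⊥-elim (<-asym lt (lex-<ʰ w'<Q h'<h))

lex-injective : ∀ {Q h h' w w'} → w < Q → w' < Q → h * Q + w ≡ h' * Q + w' → h ≡ h' × w ≡ w'
lex-injective {Q} {h} {h'} w<Q w'<Q eq with <-cmp h h'
... | tri< h<h' _ _ = ⊥-elim (<⇒≢ (lex-<ʰ w<Q h<h') eq)
... | tri≈ _ refl _ = refl , +-cancelˡ-≡ (h * Q) _ _ eq
... | tri> _ _ h'<h = ⊥-elim (<⇒≢ (lex-<ʰ w'<Q h'<h) (sym eq))

-- Smaller levels are placed higher; levels on top (true) are at most N, levels at the
-- bottom (false) at least N, and a larger x moves a line further towards its side.
module Levels (N : ℕ) where

  level : Bool → ℕ → ℕ
  level true x = N ∸ x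
  level false x = N + x

  level-< : ∀ σ {x} → x ≤ N → level σ x < suc (N + N)
  level-< true {x} _ = s≤s (≤-trans (m∸n≤m N x) (m≤m+n N N))
  level-< false x≤N = s≤s (+-monoʳ-≤ N x≤N)

  top-above : ∀ {σ τ x y} → σ ≡ true → y < x → x ≤ N → level σ x < level τ y
  top-above {τ = true} refl y<x x≤N = ∸-monoʳ-< y<x x≤N
  top-above {τ = false} {x} {y} refl y<x x≤N = <-≤-trans (∸-monoʳ-< (≤-<-trans z≤n y<x) x≤N) (m≤m+n N y)

  bottom-below : ∀ {σ τ x y} → σ ≡ false → y < x → level τ y < level σ x
  bottom-below {τ = true} {x} {y} refl y<x = ≤-<-trans (m∸n≤m N y) (m<m+n N (≤-<-trans z≤n y<x))
  bottom-below {τ = false} refl y<x = +-monoʳ-< N y<x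

  top-below-bottom : ∀ {σ τ x y} → σ ≡ true → τ ≡ false → 0 < y → level σ x < level τ y
  top-below-bottom {x = x} refl refl 0<y = ≤-<-trans (m∸n≤m N x) (m<m+n N 0<y)

  bottom≮top : ∀ {σ τ x y} → σ ≡ false → τ ≡ true → ¬ level σ x < level τ y
  bottom≮top {x = x} {y} refl refl lt = <⇒≱ lt (≤-trans (m∸n≤m N y) (m≤m+n N x))

  level-injective : ∀ {σ τ x y} → 0 < x → 0 < y → x ≤ N → y ≤ N →
    level σ x ≡ level τ y → x ≡ y
  level-injective {true} {true} _ _ x≤N y≤N eq = ∸-cancelˡ-≡ x≤N y≤N eq
  level-injective {false} {false} _ _ _ _ eq = +-cancelˡ-≡ N _ _ eq
  level-injective {true} {false} {x} _ 0<y _ _ eq =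
    ⊥-elim (<⇒≢ (top-below-bottom {x = x} refl refl 0<y) eq)
  level-injective {false} {true} {y = y} 0<x _ _ _ eq =
    ⊥-elim (<⇒≢ (top-below-bottom {x = y} refl refl 0<x) (sym eq))

module _ {A : Set} where
  open import Algebra.Properties.CommutativeSemigroup +-commutativeSemigroup using (interchange)

  sum-map-+ : ∀ (f g : A → ℕ) xs → sum (map (λ x → f x + g x) xs) ≡ sum (map f xs) + sum (map g xs)
  sum-map-+ f g [] = refl
  sum-map-+ f g (x ∷ xs) = trans (cong (f x + g x +_) (sum-map-+ f g xs))
    (interchange (f x) (g x) (sum (map f xs)) (sum (map g xs)))

  sum-map-0 : ∀ (f : A → ℕ) xs → (∀ {x} → x ∈ xs → f x ≡ 0) → sum (map f xs) ≡ 0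
  sum-map-0 f [] _ = refl
  sum-map-0 f (x ∷ xs) f≡0 = cong₂ _+_ (f≡0 (here refl)) (sum-map-0 f xs (f≡0 ∘ there))

  sum-map-mono : ∀ {f g : A → ℕ} xs → (∀ {x} → x ∈ xs → f x ≤ g x) →
    sum (map f xs) ≤ sum (map g xs)
  sum-map-mono [] _ = z≤n
  sum-map-mono (x ∷ xs) f≤g = +-mono-≤ (f≤g (here refl)) (sum-map-mono xs (f≤g ∘ there))

  ∈⇒≤sum-map : ∀ (f : A → ℕ) {x xs} → x ∈ xs → f x ≤ sum (map f xs)
  ∈⇒≤sum-map f {xs = y ∷ xs} (here refl) = m≤m+n (f y) _
  ∈⇒≤sum-map f {xs = y ∷ xs} (there x∈) = ≤-trans (∈⇒≤sum-map f x∈) (m≤n+m _ (f y))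

  sum-map-≤-single : ∀ (f : A → ℕ) {xs m} → Unique xs → (∀ x → f x ≤ 1) →
    (∀ {x y} → 0 < f x → 0 < f y → x ≡ y) → (∀ {x} → x ∈ xs → 0 < f x → 1 ≤ m) →
    sum (map f xs) ≤ m
  sum-map-≤-single f {[]} _ _ _ _ = z≤n
  sum-map-≤-single f {x ∷ xs} {m} (x∉ ∷ u) f≤1 single pos with f x in fx
  ... | zero = sum-map-≤-single f u f≤1 single (pos ∘ there)
  ... | suc k = subst (_≤ m) (sym (cong₂ _+_ (cong suc k≡0) (sum-map-0 f xs rest≡0))) (pos (here refl) 0<fx)
    where
    0<fx : 0 < f x
    0<fx = subst (0 <_) (sym fx) (s≤s z≤n)
    k≡0 : k ≡ 0
    k≡0 = n≤0⇒n≡0 (≤-pred (subst (_≤ 1) fx (f≤1 x)))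
    rest≡0 : ∀ {y} → y ∈ xs → f y ≡ 0
    rest≡0 {y} y∈ with f y in fy
    ... | zero = refl
    ... | suc _ = ⊥-elim (All.lookup x∉ y∈ (single 0<fx (subst (0 <_) (sym fy) (s≤s z≤n))))

sum-map-comm : ∀ {B C : Set} (f : B → C → ℕ) xs ys →
  sum (map (λ x → sum (map (f x) ys)) xs) ≡ sum (map (λ y → sum (map (λ x → f x y) xs)) ys)
sum-map-comm f [] ys = sym (sum-map-0 (λ _ → 0) ys (λ _ → refl))
sum-map-comm f (x ∷ xs) ys = trans (cong (sum (map (f x) ys) +_) (sum-map-comm f xs ys))
  (sym (sum-map-+ (f x) (λ y → sum (map (λ x → f x y) xs)) ys))

sublists : ∀ {A : Set} → List A → List (List A)
sublists [] = [] ∷ []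
sublists (x ∷ xs) = map (x ∷_) (sublists xs) ++ sublists xs

filter∈sublists : ∀ {A : Set} {P : A → Set} (P? : Decidable P) xs → filter P? xs ∈ sublists xs
filter∈sublists P? [] = here refl
filter∈sublists P? (x ∷ xs) with P? x
... | yes _ = ∈-++⁺ˡ (∈-map⁺ (x ∷_) (filter∈sublists P? xs))
... | no _ = ∈-++⁺ʳ (map (x ∷_) (sublists xs)) (filter∈sublists P? xs)

traverses⇒< : ∀ {l e} → Traverses l e → e < proj₂ l
traverses⇒< {l} {e} (_ , e+1≤b) = subst (_≤ proj₂ l) (+-comm e 1) e+1≤b

<⇒traverses : ∀ {l e} → proj₁ l ≤ e → e < proj₂ l → Traverses l e
<⇒traverses {l} {e} a≤e e<b = a≤e , subst (_≤ proj₂ l) (+-comm 1 e) e<b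

traverses-first : ∀ {n a b} → ValidLine n (a , b) → Traverses (a , b) a
traverses-first (_ , a<b , _) = <⇒traverses ≤-refl a<b

traverses-last : ∀ {n a e} → ValidLine n (a , suc e) → Traverses (a , suc e) e
traverses-last {e = e} (_ , a<1+e , _) = <⇒traverses (≤-pred a<1+e) (n<1+n e)

traverses⇒IsEdge : ∀ {n l e} → ValidLine n l → Traverses l e → IsEdge n e
traverses⇒IsEdge (1≤a , _ , b≤n) (a≤e , e+1≤b) = ≤-trans 1≤a a≤e , ≤-trans e+1≤b b≤n

exits-or-continues : ∀ {e l} → Traverses l e → proj₂ l ≡ suc e ⊎ suc e < proj₂ l
exits-or-continues tl with m≤n⇒m<n∨m≡n (traverses⇒< tl)
... | inj₁ e<b = inj₂ e<b
... | inj₂ e≡b = inj₁ (sym e≡b)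

passes⇒traverses : ∀ {l i} → PassesThrough l i → Traverses l i
passes⇒traverses (a<i , i<b) = <⇒traverses (<⇒≤ a<i) i<b

passes⇒traverses-before : ∀ {l e} → PassesThrough l (suc e) → Traverses l e
passes⇒traverses-before {e = e} (a<1+e , 1+e<b) = <⇒traverses (≤-pred a<1+e) (<-trans (n<1+n e) 1+e<b)

traverses⇒passes : ∀ {p st e} → proj₁ p < st → st ≤ e → Traverses p e → PassesThrough p st
traverses⇒passes a<st st≤e tp = a<st , ≤-<-trans st≤e (traverses⇒< tp)

IsEdge⇒∈edges : ∀ {n e} → IsEdge n e → e ∈ edges n
IsEdge⇒∈edges {suc n} {suc e} (_ , e+1≤n) =
  ∈-applyUpTo⁺ suc (≤-pred (subst (_≤ suc n) (+-comm (suc e) 1) e+1≤n))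

unique-edges : ∀ n → Unique (edges n)
unique-edges n = Unique.drop⁺ 1 (Unique.upTo⁺ n)

Swapped : Layout → ℕ → Line → Line → Set
Swapped lay e l l' = above (lay e L) l l' ≡ true × above (lay e R) l' l ≡ true

swaps : Layout → ℕ → Line → Line → ℕ
swaps lay e l l' = if above (lay e L) l l' ∧ above (lay e R) l' l then 1 else 0

swaps-≤1 : ∀ lay e l l' → swaps lay e l l' ≤ 1
swaps-≤1 lay e l l' with above (lay e L) l l' ∧ above (lay e R) l' l
... | true = ≤-refl
... | false = z≤n

swaps-positive : ∀ lay e l l' → 0 < swaps lay e l l' → Swapped lay e l l'
swaps-positive lay e l l' pos with above (lay e L) l l' | above (lay e R) l' l
... | true | true = refl , refl
... | true | false = ⊥-elim (<-irrefl refl pos)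
... | false | _ = ⊥-elim (<-irrefl refl pos)

Swapped⇒swaps≡1 : ∀ lay e l l' → Swapped lay e l l' → swaps lay e l l' ≡ 1
Swapped⇒swaps≡1 lay e l l' (left , right) rewrite left | right = refl

swapCount : Instance → Layout → Line → Line → ℕ
swapCount I lay l l' = sum (map (λ e → swaps lay e l l') (edges (Instance.n I)))

crossingNumber-by-pairs : ∀ I lay → let open Instance I in
  crossingNumber I lay ≡ sum (map (λ l → sum (map (swapCount I lay l) lines)) lines)
crossingNumber-by-pairs I lay = trans
  (sum-map-comm (λ e l → sum (map (swaps lay e l) lines)) (edges n) lines)
  (cong sum (map-cong (λ l → sum-map-comm (λ e l' → swaps lay e l l') (edges n) lines) lines))
  where open Instance I

-- Being kept at the bottom also provides a line through the station: a line with none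
-- counts as kept on top.
Pinned : List Line → List Line → ℕ → Line → Bool → Set
Pinned ls xs st l true = ∀ p → p ∈ ls → PassesThrough p st → above xs l p ≡ true
Pinned ls xs st l false =
  (∀ p → p ∈ ls → PassesThrough p st → above xs p l ≡ true) × ∃ λ p → p ∈ ls × PassesThrough p st

Sides : Instance → Layout → (Line → Bool) → (Line → Bool) → Set
Sides I lay s t = ∀ {a b} → (a , b) ∈ lines →
  Pinned lines (lay a L) a (a , b) (s (a , b)) × Pinned lines (lay (pred b) R) b (a , b) (t (a , b))
  where open Instance I

-- The canonical layout

module Candidate (I : Instance) (s t : Line → Bool) where
  open Instance I

  N : ℕ
  N = suc n

  Q : ℕ
  Q = suc (N + N)

  open Levels N

  -- entry puts a line kept on top (bottom) at its first station above (below) every line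
  -- passing through that station; exit does the same at the last station, where N ∸ b makes
  -- the line leaving first the outermost one on its side.
  entry exit : Line → ℕ
  entry (a , b) = level (s (a , b)) a
  exit (a , b) = level (t (a , b)) (N ∸ b)

  leftKey : Line → ℕ
  leftKey l = entry l * Q + exit l

  -- At the station-(e+1) end of edge e the lines leaving on top come first, then the lines
  -- continuing in their left-end order, then the lines leaving at the bottom.
  exitBlock : Bool → ℕ
  exitBlock true = 0
  exitBlock false = 2

  block : ℕ → Line → ℕ
  block e (a , b) with b ≟ suc e
  ... | yes _ = exitBlock (t (a , b))
  ... | no _ = 1

  rightKey : ℕ → Line → ℕ
  rightKey e l = block e l * (Q * Q) + leftKey l

  candidate : Layout
  candidate e L = SortOn.sort leftKey (linesOn lines e)
  candidate e R = SortOn.sort (rightKey e) (linesOn lines e)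

  valid-∈ : ∀ {l} → l ∈ lines → ValidLine n l
  valid-∈ = All.lookup valid

  ∈-linesOn : ∀ {l e} → l ∈ lines → Traverses l e → l ∈ linesOn lines e
  ∈-linesOn = ∈-filter⁺ (λ l → traverses? l _)

  linesOn-∈ : ∀ {l e} → l ∈ linesOn lines e → l ∈ lines × Traverses l e
  linesOn-∈ = ∈-filter⁻ (λ l → traverses? l _)

  unique-linesOn : ∀ e → Unique (linesOn lines e)
  unique-linesOn e = Unique.filter⁺ (λ l → traverses? l e) distinct

  start≤N : ∀ {l} → l ∈ lines → proj₁ l ≤ N
  start≤N l∈ with valid-∈ l∈
  ... | _ , a<b , b≤n = ≤-trans (<⇒≤ a<b) (m≤n⇒m≤1+n b≤n)

  end<N : ∀ {l} → l ∈ lines → proj₂ l < N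
  end<N l∈ = s≤s (proj₂ (proj₂ (valid-∈ l∈)))

  entry-< : ∀ {l} → l ∈ lines → entry l < Q
  entry-< {a , b} l∈ = level-< (s (a , b)) (start≤N l∈)

  exit-< : ∀ {l} → l ∈ lines → exit l < Q
  exit-< {a , b} _ = level-< (t (a , b)) (m∸n≤m N b)

  leftKey-< : ∀ {l} → l ∈ lines → leftKey l < Q * Q
  leftKey-< {l} l∈ = subst (leftKey l <_) (+-identityʳ (Q * Q)) (lex-<ʰ (exit-< l∈) (entry-< l∈))

  leftKey-injective : ∀ {l l'} → l ∈ lines → l' ∈ lines → leftKey l ≡ leftKey l' → l ≡ l'
  leftKey-injective {a , b} {a' , b'} l∈ l'∈ eq with lex-injective (exit-< l∈) (exit-< l'∈) eq
  ... | entry≡ , exit≡ = cong₂ _,_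
    (level-injective {s (a , b)} {s (a' , b')} (proj₁ (valid-∈ l∈)) (proj₁ (valid-∈ l'∈))
      (start≤N l∈) (start≤N l'∈) entry≡)
    (∸-cancelˡ-≡ (<⇒≤ (end<N l∈)) (<⇒≤ (end<N l'∈))
      (level-injective {t (a , b)} {t (a' , b')} (m<n⇒0<n∸m (end<N l∈)) (m<n⇒0<n∸m (end<N l'∈))
        (m∸n≤m N b) (m∸n≤m N b') exit≡))

  rightKey-injective : ∀ {e l l'} → l ∈ lines → l' ∈ lines → rightKey e l ≡ rightKey e l' → l ≡ l'
  rightKey-injective {e} {l} {l'} l∈ l'∈ eq = leftKey-injective l∈ l'∈
    (proj₂ (lex-injective {h = block e l} {h' = block e l'} (leftKey-< l∈) (leftKey-< l'∈) eq))

  above-left : ∀ {e l l'} → l ∈ lines → l' ∈ lines → Traverses l e → Traverses l' e →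
    above (candidate e L) l l' ≡ (leftKey l <ᵇ leftKey l')
  above-left {e} l∈ l'∈ tl tl' = SortOn.above-sort leftKey (unique-linesOn e)
    (λ x∈ y∈ → leftKey-injective (proj₁ (linesOn-∈ x∈)) (proj₁ (linesOn-∈ y∈)))
    (∈-linesOn l∈ tl) (∈-linesOn l'∈ tl')

  above-right : ∀ {e l l'} → l ∈ lines → l' ∈ lines → Traverses l e → Traverses l' e →
    above (candidate e R) l l' ≡ (rightKey e l <ᵇ rightKey e l')
  above-right {e} l∈ l'∈ tl tl' = SortOn.above-sort (rightKey e) (unique-linesOn e)
    (λ x∈ y∈ → rightKey-injective (proj₁ (linesOn-∈ x∈)) (proj₁ (linesOn-∈ y∈)))
    (∈-linesOn l∈ tl) (∈-linesOn l'∈ tl')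

  block-continuing : ∀ {e l} → suc e < proj₂ l → block e l ≡ 1
  block-continuing {e} {a , b} e<b with b ≟ suc e
  ... | yes refl = ⊥-elim (<-irrefl refl e<b)
  ... | no _ = refl

  block-exiting : ∀ {e a} → block e (a , suc e) ≡ exitBlock (t (a , suc e))
  block-exiting {e} with suc e ≟ suc e
  ... | yes _ = refl
  ... | no ≢ = ⊥-elim (≢ refl)

  block-top : ∀ {e a} → t (a , suc e) ≡ true → block e (a , suc e) ≡ 0
  block-top tl = trans block-exiting (cong exitBlock tl)

  block-bottom : ∀ {e a} → t (a , suc e) ≡ false → block e (a , suc e) ≡ 2
  block-bottom tl = trans block-exiting (cong exitBlock tl)

  block-exits : ∀ {e a} →
    (t (a , suc e) ≡ true × block e (a , suc e) ≡ 0) ⊎ (t (a , suc e) ≡ false × block e (a , suc e) ≡ 2)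
  block-exits {e} {a} with t (a , suc e) in tl
  ... | true = inj₁ (refl , block-top tl)
  ... | false = inj₂ (refl , block-bottom tl)

  above-right-continuing : ∀ {e l l'} → l ∈ lines → l' ∈ lines → Traverses l e → Traverses l' e →
    suc e < proj₂ l → suc e < proj₂ l' → above (candidate e R) l l' ≡ (leftKey l <ᵇ leftKey l')
  above-right-continuing {e} {l} {l'} l∈ l'∈ tl tl' e<b e<b' = begin
    above (candidate e R) l l'                           ≡⟨ above-right l∈ l'∈ tl tl' ⟩
    rightKey e l <ᵇ rightKey e l'
      ≡⟨ cong₂ (λ x y → x * (Q * Q) + leftKey l <ᵇ y * (Q * Q) + leftKey l')
           (block-continuing e<b) (block-continuing e<b') ⟩
    1 * (Q * Q) + leftKey l <ᵇ 1 * (Q * Q) + leftKey l'  ≡⟨ +-<ᵇ (1 * (Q * Q)) ⟩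
    leftKey l <ᵇ leftKey l'                              ∎
    where open ≡-Reasoning

  wellFormed : WellFormed I candidate
  wellFormed e _ L = SortOn.sort-↭ leftKey (linesOn lines e)
  wellFormed e _ R = SortOn.sort-↭ (rightKey e) (linesOn lines e)

  admissible : Admissible I candidate
  admissible (suc e) _ _ l l' l∈ l'∈ pl pl' = trans
    (above-right-continuing l∈ l'∈ (passes⇒traverses-before pl) (passes⇒traverses-before pl')
      (proj₂ pl) (proj₂ pl'))
    (sym (above-left l∈ l'∈ (passes⇒traverses pl) (passes⇒traverses pl')))

  leftKey-top : ∀ {l p} → l ∈ lines → s l ≡ true → proj₁ p < proj₁ l → leftKey l < leftKey p
  leftKey-top {l} {p} l∈ sl a'<a = lex-<ʰ (exit-< l∈) (top-above {τ = s p} sl a'<a (start≤N l∈))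

  leftKey-bottom : ∀ {l p} → p ∈ lines → s l ≡ false → proj₁ p < proj₁ l → leftKey p < leftKey l
  leftKey-bottom {l} {p} p∈ sl a'<a = lex-<ʰ (exit-< p∈) (bottom-below {τ = s p} sl a'<a)

  rightKey-top : ∀ {e a p} → (a , suc e) ∈ lines → t (a , suc e) ≡ true → suc e < proj₂ p →
    rightKey e (a , suc e) < rightKey e p
  rightKey-top {e} {a} {p} l∈ tl e<b' = lex-<ʰ {h = block e (a , suc e)} {block e p} (leftKey-< l∈)
    (subst₂ _<_ (sym (block-top tl)) (sym (block-continuing {l = p} e<b')) (s≤s z≤n))

  rightKey-bottom : ∀ {e a p} → p ∈ lines → t (a , suc e) ≡ false → suc e < proj₂ p →
    rightKey e p < rightKey e (a , suc e)
  rightKey-bottom {e} {a} {p} p∈ tl e<b' = lex-<ʰ {h = block e p} {block e (a , suc e)} (leftKey-< p∈)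
    (subst₂ _<_ (sym (block-continuing {l = p} e<b')) (sym (block-bottom tl)) (s≤s (s≤s z≤n)))

  peripheral-start : ∀ {a b} → (a , b) ∈ lines → Extreme lines (candidate a L) a (a , b)
  peripheral-start {a} {b} l∈ with s (a , b) in sl
  ... | true = inj₁ λ p p∈ pp →
    trans (above-left l∈ p∈ (traverses-first (valid-∈ l∈)) (passes⇒traverses pp))
      (<⇒<ᵇ≡true (leftKey-top l∈ sl (proj₁ pp)))
  ... | false = inj₂ λ p p∈ pp →
    trans (above-left p∈ l∈ (passes⇒traverses pp) (traverses-first (valid-∈ l∈)))
      (<⇒<ᵇ≡true (leftKey-bottom p∈ sl (proj₁ pp)))

  peripheral-end : ∀ {a e} → (a , suc e) ∈ lines → Extreme lines (candidate e R) (suc e) (a , suc e)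
  peripheral-end {a} {e} l∈ with t (a , suc e) in tl
  ... | true = inj₁ λ p p∈ pp →
    trans (above-right l∈ p∈ (traverses-last (valid-∈ l∈)) (passes⇒traverses-before pp))
      (<⇒<ᵇ≡true (rightKey-top l∈ tl (proj₂ pp)))
  ... | false = inj₂ λ p p∈ pp →
    trans (above-right p∈ l∈ (passes⇒traverses-before pp) (traverses-last (valid-∈ l∈)))
      (<⇒<ᵇ≡true (rightKey-bottom p∈ tl (proj₂ pp)))

  periphery : Periphery I candidate
  periphery a zero l∈ = ⊥-elim (<⇒≱ (proj₁ (proj₂ (valid-∈ l∈))) z≤n)
  periphery a (suc e) l∈ = peripheral-start l∈ , peripheral-end l∈

  feasible : Feasible I candidate
  feasible = wellFormed , admissible , periphery

  crosses-at-last-edge : ∀ {i j i' j' e} → (i , j) ∈ lines → (i' , j') ∈ lines → j < j' →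
    Cross candidate e (i , j) (i' , j') → e + 1 ≡ j
  crosses-at-last-edge {e = e} l∈ l'∈ j<j' (tl , tl' , differ) with exits-or-continues tl
  ... | inj₁ refl = +-comm e 1
  ... | inj₂ e<j = ⊥-elim (differ (trans (above-left l∈ l'∈ tl tl')
    (sym (above-right-continuing l∈ l'∈ tl tl' e<j (<-trans e<j j<j')))))

  data BlockAbove (e : ℕ) : Line → Line → Set where
    top-exit    : ∀ {a a' b} → t (a' , suc e) ≡ true → suc e < b → BlockAbove e (a' , suc e) (a , b)
    bottom-exit : ∀ {a a' b'} → t (a , suc e) ≡ false → suc e < b' → BlockAbove e (a' , b') (a , suc e)
    both-exit   : ∀ {a a'} → t (a' , suc e) ≡ true → t (a , suc e) ≡ false →
                  BlockAbove e (a' , suc e) (a , suc e)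

  block-<⇒BlockAbove : ∀ {e l l'} → Traverses l e → Traverses l' e →
    block e l' < block e l → BlockAbove e l' l
  block-<⇒BlockAbove {e} {a , b} {a' , b'} tl tl' lt with exits-or-continues tl | exits-or-continues tl'
  ... | inj₁ refl | inj₁ refl with block-exits {e} {a} | block-exits {e} {a'}
  ...   | inj₂ (tl₀ , _) | inj₁ (tl₀' , _) = both-exit tl₀' tl₀
  ...   | inj₁ (_ , top) | _ = ⊥-elim (n≮0 (subst (_ <_) top lt))
  ...   | inj₂ (_ , bottom) | inj₂ (_ , bottom') = ⊥-elim (<-irrefl refl (subst₂ _<_ bottom' bottom lt))
  block-<⇒BlockAbove {e} {a , _} tl tl' lt | inj₁ refl | inj₂ e<b' with block-exits {e} {a}
  ... | inj₂ (tl₀ , _) = bottom-exit tl₀ e<b'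
  ... | inj₁ (_ , top) = ⊥-elim (n≮0 (subst (_ <_) top lt))
  block-<⇒BlockAbove {e} {l = l} {a' , _} tl tl' lt | inj₂ e<b | inj₁ refl with block-exits {e} {a'}
  ... | inj₁ (tl₀' , _) = top-exit tl₀' e<b
  ... | inj₂ (_ , bottom') =
    ⊥-elim (<⇒≯ (s≤s (s≤s z≤n)) (subst₂ _<_ bottom' (block-continuing {l = l} e<b) lt))
  block-<⇒BlockAbove {l = l} {l'} tl tl' lt | inj₂ e<b | inj₂ e<b' =
    ⊥-elim (<-irrefl refl (subst₂ _<_ (block-continuing {l = l'} e<b') (block-continuing {l = l} e<b) lt))

  BlockAbove⇒exit-< : ∀ {e l l'} → l ∈ lines → l' ∈ lines → BlockAbove e l' l → exit l' < exit l
  BlockAbove⇒exit-< {e} {a , b} l∈ _ (top-exit tl' e<b) =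
    top-above {τ = t (a , b)} tl' (∸-monoʳ-< e<b (<⇒≤ (end<N l∈))) (m∸n≤m N (suc e))
  BlockAbove⇒exit-< {e} {l' = a' , b'} _ l'∈ (bottom-exit tl e<b') =
    bottom-below {τ = t (a' , b')} tl (∸-monoʳ-< e<b' (<⇒≤ (end<N l'∈)))
  BlockAbove⇒exit-< {e} l∈ _ (both-exit tl' tl) =
    top-below-bottom {x = N ∸ suc e} tl' tl (m<n⇒0<n∸m (end<N l∈))

  BlockAbove⇒last-edge : ∀ {e l l'} → BlockAbove e l' l → suc e ≡ proj₂ l ⊓ proj₂ l'
  BlockAbove⇒last-edge (top-exit _ e<b) = sym (m≥n⇒m⊓n≡n (<⇒≤ e<b))
  BlockAbove⇒last-edge (bottom-exit _ e<b') = sym (m≤n⇒m⊓n≡m (<⇒≤ e<b'))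
  BlockAbove⇒last-edge {e} (both-exit _ _) = sym (⊓-idem (suc e))

  swapped⇒traverses : ∀ {e l l'} → Swapped candidate e l l' →
    (l ∈ lines × Traverses l e) × (l' ∈ lines × Traverses l' e)
  swapped⇒traverses {e} (left , _) = Product.map fromCandidate fromCandidate (above⇒∈ (candidate e L) left)
    where
    fromCandidate : ∀ {x} → x ∈ candidate e L → x ∈ lines × Traverses x e
    fromCandidate x∈ = linesOn-∈ (∈-resp-↭ (SortOn.sort-↭ leftKey (linesOn lines e)) x∈)

  module _ {e l l'} (l∈ : l ∈ lines) (l'∈ : l' ∈ lines) (tl : Traverses l e) (tl' : Traverses l' e)
           (swapped : Swapped candidate e l l') where

    private
      leftKey-<′ : leftKey l < leftKey l'
      leftKey-<′ = <ᵇ≡true⇒< (trans (sym (above-left l∈ l'∈ tl tl')) (proj₁ swapped))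

    swapped⇒BlockAbove : BlockAbove e l' l
    swapped⇒BlockAbove
      with lex-<⁻¹ (leftKey-< l∈) (<ᵇ≡true⇒< (trans (sym (above-right l'∈ l∈ tl' tl)) (proj₂ swapped)))
    ... | inj₁ block< = block-<⇒BlockAbove tl tl' block<
    ... | inj₂ (_ , key<) = ⊥-elim (<-asym key< leftKey-<′)

    swapped⇒entry-< : entry l < entry l'
    swapped⇒entry-< with lex-<⁻¹ (exit-< l'∈) leftKey-<′
    ... | inj₁ entry< = entry<
    ... | inj₂ (_ , exit<) = ⊥-elim (<-asym exit< (BlockAbove⇒exit-< l∈ l'∈ swapped⇒BlockAbove))

  swapped⇒last-edge : ∀ {e l l'} → Swapped candidate e l l' → suc e ≡ proj₂ l ⊓ proj₂ l'
  swapped⇒last-edge swapped with swapped⇒traverses swapped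
  ... | (l∈ , tl) , (l'∈ , tl') = BlockAbove⇒last-edge (swapped⇒BlockAbove l∈ l'∈ tl tl' swapped)

-- Comparison with a feasible layout

module Domination (I : Instance) (s t : Line → Bool) (lay : Layout)
                  (wf : WellFormed I lay) (adm : Admissible I lay) (sides : Sides I lay s t) where
  open Instance I
  open Candidate I s t
  open Levels N

  ∈-lay : ∀ {l e} σ → l ∈ lines → Traverses l e → l ∈ lay e σ
  ∈-lay {e = e} σ l∈ tl =
    ∈-resp-↭ (↭-sym (wf e (traverses⇒IsEdge (valid-∈ l∈) tl) σ)) (∈-linesOn l∈ tl)

  unique-lay : ∀ {e} σ → IsEdge n e → Unique (lay e σ)
  unique-lay {e} σ ie = unique-↭ (↭-sym (wf e ie σ)) (unique-linesOn e)

  module _ {a b} (l∈ : (a , b) ∈ lines) where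

    top-at-start : s (a , b) ≡ true → Pinned lines (lay a L) a (a , b) true
    top-at-start sl = subst (Pinned lines (lay a L) a (a , b)) sl (proj₁ (sides l∈))

    bottom-at-start : s (a , b) ≡ false → Pinned lines (lay a L) a (a , b) false
    bottom-at-start sl = subst (Pinned lines (lay a L) a (a , b)) sl (proj₁ (sides l∈))

    top-at-end : t (a , b) ≡ true → Pinned lines (lay (pred b) R) b (a , b) true
    top-at-end tl = subst (Pinned lines (lay (pred b) R) b (a , b)) tl (proj₂ (sides l∈))

    bottom-at-end : t (a , b) ≡ false → Pinned lines (lay (pred b) R) b (a , b) false
    bottom-at-end tl = subst (Pinned lines (lay (pred b) R) b (a , b)) tl (proj₂ (sides l∈))

  entry-order-realised : ∀ {e l l'} → l ∈ lines → l' ∈ lines → Traverses l e → Traverses l' e →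
    entry l < entry l' → ∃ λ f → proj₁ l ≤ f × proj₁ l' ≤ f × f ≤ e × above (lay f L) l l' ≡ true
  entry-order-realised {e} {a , b} {a' , b'} l∈ l'∈ tl tl' lt
    with s (a , b) in sl | s (a' , b') in sl' | <-cmp a a'
  -- Abstracting the sides turns lt into an inequality between the concrete levels.
  ... | true | true | _ = a , ≤-refl , <⇒≤ a'<a , proj₁ tl ,
        top-at-start l∈ sl _ l'∈ (traverses⇒passes a'<a (proj₁ tl) tl')
    where a'<a = ∸-cancelʳ-< lt
  ... | false | false | _ = a' , <⇒≤ a<a' , ≤-refl , proj₁ tl' ,
        proj₁ (bottom-at-start l'∈ sl') _ l∈ (traverses⇒passes a<a' (proj₁ tl') tl)
    where a<a' = +-cancelˡ-< N a a' lt
  ... | false | true | _ = ⊥-elim (bottom≮top {false} {true} {a} {a'} refl refl lt)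
  ... | true | false | tri< a<a' _ _ = a' , <⇒≤ a<a' , ≤-refl , proj₁ tl' ,
        proj₁ (bottom-at-start l'∈ sl') _ l∈ (traverses⇒passes a<a' (proj₁ tl') tl)
  ... | true | false | tri> _ _ a'<a = a , ≤-refl , <⇒≤ a'<a , proj₁ tl ,
        top-at-start l∈ sl _ l'∈ (traverses⇒passes a'<a (proj₁ tl) tl')
  ... | true | false | tri≈ _ refl _ with bottom-at-start l'∈ sl'
  ...   | below , p , p∈ , pp = a , ≤-refl , ≤-refl , proj₁ tl ,
          above-trans (unique-lay L (traverses⇒IsEdge (valid-∈ l∈) (traverses-first (valid-∈ l∈))))
            (top-at-start l∈ sl p p∈ pp) (below p p∈ pp)

  exit-order-realised : ∀ {e l l'} → l ∈ lines → l' ∈ lines → Traverses l e → Traverses l' e →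
    BlockAbove e l' l → above (lay e R) l' l ≡ true
  exit-order-realised l∈ l'∈ tl tl' (top-exit tl₀' e<b) =
    top-at-end l'∈ tl₀' _ l∈ (s≤s (proj₁ tl) , e<b)
  exit-order-realised l∈ l'∈ tl tl' (bottom-exit tl₀ e<b') =
    proj₁ (bottom-at-end l∈ tl₀) _ l'∈ (s≤s (proj₁ tl') , e<b')
  exit-order-realised l∈ l'∈ tl tl' (both-exit tl₀' tl₀) with bottom-at-end l∈ tl₀
  ... | below , p , p∈ , pp = above-trans (unique-lay R (traverses⇒IsEdge (valid-∈ l∈) tl))
    (top-at-end l'∈ tl₀' p p∈ pp) (below p p∈ pp)

  carried-back : ∀ {e l l'} → l ∈ lines → l' ∈ lines →
    PassesThrough l (suc e) → PassesThrough l' (suc e) →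
    above (lay (suc e) L) l l' ≡ true → above (lay e R) l l' ≡ true
  carried-back {e} l∈ l'∈ pl pl' = trans
    (adm (suc e) (≤-<-trans (proj₁ (valid-∈ l∈)) (proj₁ pl))
      (<-≤-trans (proj₂ pl) (proj₂ (proj₂ (valid-∈ l∈))))
      _ _ l∈ l'∈ pl pl')

  swap-between : ∀ {l l' f} e → l ∈ lines → l' ∈ lines → l ≢ l' →
    proj₁ l ≤ f → proj₁ l' ≤ f → f ≤ e → e < proj₂ l → e < proj₂ l' →
    above (lay f L) l l' ≡ true → above (lay e R) l' l ≡ true → ∃ λ x → IsEdge n x × Swapped lay x l l'
  swap-between {l} {l'} e l∈ l'∈ l≢l' a≤f a'≤f f≤e e<b e<b' left right
    with above (lay e L) l l' in at-e | m≤n⇒m<n∨m≡n f≤e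
  ... | true | _ = e , traverses⇒IsEdge (valid-∈ l∈) (<⇒traverses (≤-trans a≤f f≤e) e<b) , at-e , right
  ... | false | inj₂ refl = contradiction (trans (sym left) at-e) λ ()
  swap-between {l} {l'} (suc e) l∈ l'∈ l≢l' a≤f a'≤f f≤e e<b e<b' left right
    | false | inj₁ (s≤s f≤e') =
    swap-between e l∈ l'∈ l≢l' a≤f a'≤f f≤e' (<-trans (n<1+n e) e<b) (<-trans (n<1+n e) e<b') left
      (carried-back l'∈ l∈ (s≤s (≤-trans a'≤f f≤e') , e<b') (s≤s (≤-trans a≤f f≤e') , e<b) l'-above)
    where
    l'-above : above (lay (suc e) L) l' l ≡ true
    l'-above with above-total (∈-lay L l∈ (<⇒traverses (≤-trans a≤f f≤e) e<b))
                              (∈-lay L l'∈ (<⇒traverses (≤-trans a'≤f f≤e) e<b')) l≢l'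
    ... | inj₁ l-above = contradiction (trans (sym l-above) at-e) λ ()
    ... | inj₂ l'-above = l'-above

  swap-reflected : ∀ {e l l'} → Swapped candidate e l l' → ∃ λ x → IsEdge n x × Swapped lay x l l'
  swap-reflected {e} {l} {l'} swapped with swapped⇒traverses swapped
  ... | (l∈ , tl) , (l'∈ , tl')
    with entry-order-realised l∈ l'∈ tl tl' (swapped⇒entry-< l∈ l'∈ tl tl' swapped)
  ... | f , a≤f , a'≤f , f≤e , left =
    swap-between e l∈ l'∈ l≢l' a≤f a'≤f f≤e (traverses⇒< tl) (traverses⇒< tl') left
      (exit-order-realised l∈ l'∈ tl tl' (swapped⇒BlockAbove l∈ l'∈ tl tl' swapped))
    where
    l≢l' : l ≢ l'
    l≢l' refl = <-irrefl refl (swapped⇒entry-< l∈ l'∈ tl tl' swapped)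

  swaps-dominated : ∀ l l' → swapCount I candidate l l' ≤ swapCount I lay l l'
  swaps-dominated l l' = sum-map-≤-single (λ e → swaps candidate e l l') (unique-edges n)
    (λ e → swaps-≤1 candidate e l l') same-edge reflected
    where
    same-edge : ∀ {e e'} → 0 < swaps candidate e l l' → 0 < swaps candidate e' l l' → e ≡ e'
    same-edge {e} {e'} pos pos' = suc-injective (trans (swapped⇒last-edge (swaps-positive candidate e l l' pos))
      (sym (swapped⇒last-edge (swaps-positive candidate e' l l' pos'))))

    reflected : ∀ {e} → e ∈ edges n → 0 < swaps candidate e l l' → 1 ≤ swapCount I lay l l'
    reflected {e} _ pos with swap-reflected (swaps-positive candidate e l l' pos)
    ... | x , ie , sw = ≤-trans (≤-reflexive (sym (Swapped⇒swaps≡1 lay x l l' sw)))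
      (∈⇒≤sum-map (λ e → swaps lay e l l') (IsEdge⇒∈edges ie))

  candidate-dominates : crossingNumber I candidate ≤ crossingNumber I lay
  candidate-dominates = begin
    crossingNumber I candidate ≡⟨ crossingNumber-by-pairs I candidate ⟩
    _                          ≤⟨ sum-map-mono lines (λ _ → sum-map-mono lines (λ _ → swaps-dominated _ _)) ⟩
    _                          ≡⟨ sym (crossingNumber-by-pairs I lay) ⟩
    crossingNumber I lay       ∎
    where open ≤-Reasoning

module ReadSides (I : Instance) (lay : Layout) (periphery : Periphery I lay) where
  open Instance I

  TopAt : List Line → ℕ → Line → Set
  TopAt xs st l = All (λ p → PassesThrough p st → above xs l p ≡ true) lines

  passes? : ∀ st p → Dec (PassesThrough p st)
  passes? st (a , b) = (a <? st) ×-dec (st <? b)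

  topAt? : ∀ xs st → Decidable (TopAt xs st)
  topAt? xs st l = All.all? (λ p → passes? st p →-dec (above xs l p Bool.≟ true)) lines

  pinned : ∀ {xs st l} → Extreme lines xs st l → Pinned lines xs st l ⌊ topAt? xs st l ⌋
  pinned {xs} {st} {l} extreme with topAt? xs st l | extreme
  ... | yes top | _ = λ p p∈ pp → All.lookup top p∈ pp
  ... | no ¬top | inj₁ top = ⊥-elim (¬top (All.tabulate (λ {p} p∈ → top p p∈)))
  ... | no ¬top | inj₂ bottom
    with find (¬All⇒Any¬ (λ p → passes? st p →-dec (above xs l p Bool.≟ true)) lines ¬top)
  ...   | p , p∈ , ¬above with passes? st p
  ...     | yes pp = bottom , p , p∈ , pp
  ...     | no ¬pp = ⊥-elim (¬above (λ pp → ⊥-elim (¬pp pp)))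

  enteringOnTop exitingOnTop : List Line
  enteringOnTop = filter (λ l → topAt? (lay (proj₁ l) L) (proj₁ l) l) lines
  exitingOnTop = filter (λ l → topAt? (lay (pred (proj₂ l)) R) (proj₂ l) l) lines

  sides : Sides I lay (λ l → elem l enteringOnTop) (λ l → elem l exitingOnTop)
  sides {a} {b} l∈ =
    subst (Pinned lines (lay a L) a (a , b))
      (sym (elem-filter (λ l → topAt? (lay (proj₁ l) L) (proj₁ l) l) l∈))
      (pinned (proj₁ (periphery a b l∈))) ,
    subst (Pinned lines (lay (pred b) R) b (a , b))
      (sym (elem-filter (λ l → topAt? (lay (pred (proj₂ l)) R) (proj₂ l) l) l∈))
      (pinned (proj₂ (periphery a b l∈)))

module Optimum (I : Instance) where
  open Instance I
  open import Data.List.Extrema.Nat using (argmin; f[argmin]≤f[xs])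

  candidateFor : List Line × List Line → Layout
  candidateFor (S , T) = Candidate.candidate I (λ l → elem l S) (λ l → elem l T)

  cost : List Line × List Line → ℕ
  cost X = crossingNumber I (candidateFor X)

  choices : List (List Line × List Line)
  choices = cartesianProduct (sublists lines) (sublists lines)

  best : List Line × List Line
  best = argmin cost ([] , []) choices

  best-≤ : ∀ {lay} → Feasible I lay → cost best ≤ crossingNumber I lay
  best-≤ {lay} (wf , adm , per) = ≤-trans
    (All.lookup (f[argmin]≤f[xs] {f = cost} ([] , []) choices)
      (∈-cartesianProduct⁺ (filter∈sublists _ lines) (filter∈sublists _ lines)))
    (Domination.candidate-dominates I _ _ lay wf adm sides)
    where open ReadSides I lay per

lemma6 : (I : Instance) → Σ Layout λ lay → Optimal I lay ×
    (∀ i j i' j' → (i , j) ∈ Instance.lines I → (i' , j') ∈ Instance.lines I → j < j' →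
    ∀ e → IsEdge (Instance.n I) e → Cross lay e (i , j) (i' , j') → e + 1 ≡ j)
lemma6 I = candidateFor best , (feasible , λ _ → best-≤) ,
  λ _ _ _ _ l∈ l'∈ j<j' _ _ → crosses-at-last-edge l∈ l'∈ j<j'
  where
  open Optimum I
  open Candidate I (λ l → elem l (proj₁ best)) (λ l → elem l (proj₂ best))
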